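{- Let $\mathcal{A}_\tau=\mathcal{A}\cup\{\tau\}$ be a countable set and let $T$ be a countable $\mathcal{A}_\tau$-labelled transition system. Then there exists an infinitary reactive Turing machine $\mathcal{M}$ such that $T$ and the transition system $\mathcal{T}(\mathcal{M})$ associated with $\mathcal{M}$ are divergence-preserving branching bisimilar.
   Context: An $\mathcal{A}_\tau$-labelled transition system is a triple $(\mathcal{S},\to,\uparrow)$ with $\mathcal{S}$ a set of states, $\to\subseteq\mathcal{S}\times\mathcal{A}_\tau\times\mathcal{S}$ and initial state $\uparrow\in\mathcal{S}$; $\tau\notin\mathcal{A}$ denotes an internal (unobservable) action. It is countable if its set of states is countable. Branching bisimilarity: write $s\xrightarrow{(a)}t$ for "$s\xrightarrow{a}t$, or $a=\tau$ and $s=t$"; $\to^*$ and $\to^+$ are the reflexive-transitive and transitive closures of $\xrightarrow{\tau}$. A branching bisimulation between $T_1=(\mathcal{S}_1,\to_1,\uparrow_1)$ and $T_2=(\mathcal{S}_2,\to_2,\uparrow_2)$ is a relation $R\subseteq\mathcal{S}_1\times\mathcal{S}_2$ such that whenever $s_1Rs_2$: (1) if $s_1\xrightarrow{a}_1s_1'$ then there are $s_2'',s_2'$ with $s_2\to_2^*s_2''\xrightarrow{(a)}_2s_2'$, $s_1Rs_2''$ and $s_1'Rs_2'$; (2) symmetrically, if $s_2\xrightarrow{a}_2s_2'$ then there are $s_1'',s_1'$ with $s_1\to_1^*s_1''\xrightarrow{(a)}_1s_1'$, $s_1''Rs_2$ and $s_1'Rs_2'$. It is divergence-preserving if moreover whenever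 $s_1Rs_2$: (3) if there is an infinite sequence $s_1=s_{1,0}\xrightarrow{\tau}s_{1,1}\xrightarrow{\tau}\cdots$ with $s_{1,i}Rs_2$ for all $i$, then there is $s_2'$ with $s_2\to^+s_2'$ and $s_{1,i}Rs_2'$ for some $i$; and (4) symmetrically for infinite $\tau$-sequences from $s_2$. $T_1,T_2$ are divergence-preserving branching bisimilar if there is such an $R$ with $\uparrow_1R\uparrow_2$. An infinitary reactive Turing machine (RTM$^\infty$) over a countable set $\mathcal{A}_\tau$ of actions and a countable set $\mathcal{D}$ of data symbols (with a blank symbol $\Box\notin\mathcal{D}$, $\mathcal{D}_\Box=\mathcal{D}\cup\{\Box\}$) is a triple $(\mathcal{S},\to,\uparrow)$ where $\mathcal{S}$ is a countable set of states, $\to\subseteq\mathcal{S}\times\mathcal{D}_\Box\times\mathcal{A}_\tau\times\mathcal{D}_\Box\times\{L,R\}\times\mathcal{S}$ is a countable relation (write $s\xrightarrow{a[d/e]M}t$), and $\uparrow\in\mathcal{S}$. Its associated transition system $\mathcal{T}(\mathcal{M})$: states are configurations $(s,\delta)$ with $s\in\mathcal{S}$ and $\delta$ a tape instance, i.e. a finite sequence over $\mathcal{D}_\Box\cup\check{\mathcal{D}}_\Box$ (where $\check{\mathcal{D}}_\Box$ is a disjoint copy of marked symbols $\check d$) containing exactly one marked symbol (the head position). For $\delta\in\mathcal{D}_\Box^*$, $\overleftarrow{\delta}$ denotes $\delta$ with its right-most symbol marked (or $\check\Box$ if $\delta$ is empty) and $\overrightarrow{\delta}$ denotes $\delta$ with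 its left-most symbol marked (or $\check\Box$ if empty). Transitions: $(s,\delta_L\check d\delta_R)\xrightarrow{a}(t,\overleftarrow{\delta_L}e\delta_R)$ iff $s\xrightarrow{a[d/e]L}t$, and $(s,\delta_L\check d\delta_R)\xrightarrow{a}(t,\delta_Le\overrightarrow{\delta_R})$ iff $s\xrightarrow{a[d/e]R}t$, for all $\delta_L,\delta_R\in\mathcal{D}_\Box^*$. The initial state is $(\uparrow,\check\Box)$. -}

module Defs where

open import Data.Nat using (ℕ; suc)
open import Data.List using (List; []; _∷_; _∷ʳ_)
open import Data.Product using (Σ; ∃; _×_; _,_)
open import Data.Sum using (_⊎_)
open import Relation.Binary.PropositionalEquality using (_≡_)
open import Relation.Binary.Construct.Closure.ReflexiveTransitive using (Star)
open import Relation.Binary.Construct.Closure.Transitive using (TransClosure)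
open import Function.Definitions using (Injective)

Countable : Set → Set
Countable X = Σ (X → ℕ) (Injective _≡_ _≡_)

data Act (A : Set) : Set where
  τ   : Act A
  act : A → Act A

record LTS (A : Set) : Set₁ where
  field
    State : Set
    _⟶[_]_ : State → Act A → State → Set
    init  : State

open LTS public

module _ {A : Set} (T : LTS A) where
  τstep : State T → State T → Set
  τstep s t = LTS._⟶[_]_ T s τ t

  τ* : State T → State T → Set
  τ* = Star τstep

  τ+ : State T → State T → Set
  τ+ = TransClosure τstep

  opt : State T → Act A → State T → Set
  opt s a t = LTS._⟶[_]_ T s a t ⊎ (a ≡ τ × s ≡ t)

module _ {A : Set} (T₁ T₂ : LTS A) where
  private
    S₁ = State T₁
    S₂ = State T₂
    _⟶₁[_]_ = LTS._⟶[_]_ T₁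
    _⟶₂[_]_ = LTS._⟶[_]_ T₂

  record IsDPBranchingBisim (R : S₁ → S₂ → Set) : Set where
    field
      fwd : ∀ {s₁ s₂ a s₁'} → R s₁ s₂ → s₁ ⟶₁[ a ] s₁' →
            ∃ λ s₂'' → ∃ λ s₂' → τ* T₂ s₂ s₂'' × opt T₂ s₂'' a s₂' ×
                                 R s₁ s₂'' × R s₁' s₂'
      bwd : ∀ {s₁ s₂ a s₂'} → R s₁ s₂ → s₂ ⟶₂[ a ] s₂' →
            ∃ λ s₁'' → ∃ λ s₁' → τ* T₁ s₁ s₁'' × opt T₁ s₁'' a s₁' ×
                                 R s₁'' s₂ × R s₁' s₂'
      div₁ : ∀ {s₁ s₂} → R s₁ s₂ → (f : ℕ → S₁) → f 0 ≡ s₁ →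
             (∀ i → f i ⟶₁[ τ ] f (Data.Nat.suc i)) → (∀ i → R (f i) s₂) →
             ∃ λ s₂' → τ+ T₂ s₂ s₂' × ∃ λ i → R (f i) s₂'
      div₂ : ∀ {s₁ s₂} → R s₁ s₂ → (g : ℕ → S₂) → g 0 ≡ s₂ →
             (∀ i → g i ⟶₂[ τ ] g (Data.Nat.suc i)) → (∀ i → R s₁ (g i)) →
             ∃ λ s₁' → τ+ T₁ s₁ s₁' × ∃ λ i → R s₁' (g i)

  DPBranchingBisimilar : Set₁
  DPBranchingBisimilar =
    Σ (S₁ → S₂ → Set) λ R → IsDPBranchingBisim R × R (init T₁) (init T₂)

data Dir : Set where
  L R : Dir

data Blank (D : Set) : Set where
  □   : Blank D
  sym : D → Blank D

-- A tape instance δ_L ď δ_R (exactly one marked symbol), represented as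
-- the triple (δ_L , d , δ_R) with δ_L, δ_R ∈ 𝒟_□* in left-to-right order.
record Tape (D : Set) : Set where
  constructor tape
  field
    left  : List (Blank D)
    head  : Blank D
    right : List (Blank D)

record RTM (A : Set) : Set₁ where
  field
    Data       : Set
    Data-ctbl  : Countable Data
    St         : Set
    St-ctbl    : Countable St
    step       : St → Blank Data → Act A → Blank Data → Dir → St → Set
    start      : St

module _ {A : Set} (M : RTM A) where
  open RTM M

  Config : Set
  Config = St × Tape Data

  data ConfStep : Config → Act A → Config → Set where
    left-snoc : ∀ {s t a d e δL x δR} → step s d a e L t →
      ConfStep (s , tape (δL ∷ʳ x) d δR) a (t , tape δL x (e ∷ δR))
    left-nil  : ∀ {s t a d e δR} → step s d a e L t →
      ConfStep (s , tape [] d δR) a (t , tape [] □ (e ∷ δR))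
    right-cons : ∀ {s t a d e δL x δR} → step s d a e R t →
      ConfStep (s , tape δL d (x ∷ δR)) a (t , tape (δL ∷ʳ e) x δR)
    right-nil : ∀ {s t a d e δL} → step s d a e R t →
      ConfStep (s , tape δL d []) a (t , tape (δL ∷ʳ e) □ [])

  𝒯 : LTS A
  𝒯 = record { State = Config ; _⟶[_]_ = ConfStep ; init = (start , tape [] □ []) }

-- An RTM∞ may have countably many control states and transitions, so it can take
-- the states of T as its control states and mimic every transition s —a→ t by
-- s —a[□/□]R→ t, never using its tape. The head then always reads a blank at the
-- right end of the tape, so a configuration is determined up to bisimilarity by
-- its control state, and the tracking relation is a strong bisimulation — which is
-- in particular a divergence-preserving branching bisimulation.
module Submission where

open import Defs
open import Data.Empty using (⊥; ⊥-elim)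
open import Data.List using ([])
open import Data.Product using (Σ; ∃; _×_; _,_)
open import Data.Sum using (inj₁)
open import Relation.Binary.Construct.Closure.ReflexiveTransitive using (ε)
open import Relation.Binary.Construct.Closure.Transitive using ([_])

module _ {A : Set} (T₁ T₂ : LTS A) where

  record IsStrongBisim (B : State T₁ → State T₂ → Set) : Set where
    field
      fwd : ∀ {s₁ s₂ a s₁'} → B s₁ s₂ → LTS._⟶[_]_ T₁ s₁ a s₁' →
            ∃ λ s₂' → LTS._⟶[_]_ T₂ s₂ a s₂' × B s₁' s₂'
      bwd : ∀ {s₁ s₂ a s₂'} → B s₁ s₂ → LTS._⟶[_]_ T₂ s₂ a s₂' →
            ∃ λ s₁' → LTS._⟶[_]_ T₁ s₁ a s₁' × B s₁' s₂'

  -- A divergence is answered by matching its first τ-step.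
  strong⇒dpBranching : ∀ {B} → IsStrongBisim B → IsDPBranchingBisim T₁ T₂ B
  strong⇒dpBranching bisim = record
    { fwd  = λ {s₂ = s₂} r p → let (s₂' , q , r') = fwd r p in
               s₂ , s₂' , ε , inj₁ q , r , r'
    ; bwd  = λ {s₁} r q → let (s₁' , p , r') = bwd r q in
               s₁ , s₁' , ε , inj₁ p , r , r'
    ; div₁ = λ _ _ _ step related → let (s₂' , q , r') = fwd (related 0) (step 0) in
               s₂' , [ q ] , 1 , r'
    ; div₂ = λ _ _ _ step related → let (s₁' , p , r') = bwd (related 0) (step 0) in
               s₁' , [ p ] , 1 , r'
    }
    where open IsStrongBisim bisim

module Simulation {A : Set} (T : LTS A) (State-ctbl : Countable (State T)) where

  data Step : State T → Blank ⊥ → Act A → Blank ⊥ → Dir → State T → Set where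
    follow : ∀ {s a t} → LTS._⟶[_]_ T s a t → Step s □ a □ R t

  machine : RTM A
  machine = record
    { Data      = ⊥
    ; Data-ctbl = (λ ()) , λ {x} → ⊥-elim x
    ; St        = State T
    ; St-ctbl   = State-ctbl
    ; step      = Step
    ; start     = init T
    }

  data Tracks : State T → Config machine → Set where
    at-right-end : ∀ {s δL} → Tracks s (s , tape δL □ [])

  tracks-strong : IsStrongBisim T (𝒯 machine) Tracks
  tracks-strong = record { fwd = fwd ; bwd = bwd }
    where
    fwd : ∀ {s c a s'} → Tracks s c → LTS._⟶[_]_ T s a s' →
          ∃ λ c' → ConfStep machine c a c' × Tracks s' c'
    fwd at-right-end p = _ , right-nil (follow p) , at-right-end

    bwd : ∀ {s c a c'} → Tracks s c → ConfStep machine c a c' →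
          ∃ λ s' → LTS._⟶[_]_ T s a s' × Tracks s' c'
    bwd at-right-end (right-nil (follow p)) = _ , p , at-right-end

theorem3 : (A : Set) → Countable A → (T : LTS A) → Countable (State T) →
    Σ (RTM A) λ M → DPBranchingBisimilar T (𝒯 M)
theorem3 A _ T State-ctbl =
  machine , Tracks , strong⇒dpBranching T (𝒯 machine) tracks-strong , at-right-end
  where open Simulation T State-ctbl
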